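{- Let $T_5(n)=(5n+1)/2$ for odd $n$ and $T_5(n)=n/2$ for even $n$. For an integer $n$ let $t^-(n)=\inf\{|T_5^{(k)}(n)|:k\ge0\}$. Then $$\liminf_{n\to\infty}\frac{\log t^-(n)}{\log n}=0 .$$
   Context: $T_5^{(k)}$ denotes the $k$-th iterate of $T_5$ (with $T_5^{(0)}(n)=n$); the liminf is over positive integers $n\to\infty$. -}

module Defs where

open import Data.Nat using (ℕ; zero; suc; _+_; _*_; _^_; _≤_; _<_; _≡ᵇ_)
open import Data.Nat.DivMod using (_/_; _%_)
open import Data.Bool using (if_then_else_)
open import Data.Product using (Σ; _×_; ∃)
open import Relation.Binary.PropositionalEquality using (_≡_)

T₅ : ℕ → ℕ
T₅ n = if (n % 2) ≡ᵇ 1 then (5 * n + 1) / 2 else n / 2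

T₅^ : ℕ → ℕ → ℕ
T₅^ zero n = n
T₅^ (suc k) n = T₅ (T₅^ k n)

-- m is the infimum of { |T₅^(k)(n)| : k ≥ 0 } (for n ∈ ℕ all iterates are ≥ 0,
-- so |·| is the identity; an infimum of a nonempty set of naturals is its minimum)
IsTMinus : ℕ → ℕ → Set
IsTMinus n m = (∃ λ k → T₅^ k n ≡ m) × (∀ k → m ≤ T₅^ k n)

{-# OPTIONS --safe #-}
module Submission where

-- Every orbit of a positive integer stays positive, so t⁻(n) ≥ 1. Conversely, T₅ halves
-- even numbers, so the orbit of 2ᵏ reaches 1 after k steps; hence t⁻(2ᵏ) = 1 and
-- log t⁻(2ᵏ) / log 2ᵏ = 0 along a sequence tending to infinity.

open import Defs
open import Data.Nat using (ℕ; zero; suc; _+_; _*_; _^_; _≤_; _<_; _≡ᵇ_; s≤s; z≤n; z<s)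
open import Data.Nat.Properties
open import Data.Nat.DivMod using (_%_; /-monoˡ-≤; m*n%n≡0; m*n/n≡m)
open import Data.Bool using (true; false)
open import Data.Product using (_×_; ∃; _,_)
open import Relation.Binary.PropositionalEquality using (_≡_; sym; trans; cong; subst; module ≡-Reasoning)

T₅-positive : ∀ n → 1 ≤ n → 1 ≤ T₅ n
T₅-positive 1 _ = s≤s z≤n
T₅-positive n@(suc (suc _)) _ with n % 2 ≡ᵇ 1
... | true  = /-monoˡ-≤ {n = 5 * n + 1} 2 (s≤s (s≤s z≤n))
... | false = /-monoˡ-≤ {n = n} 2 (s≤s (s≤s z≤n))

T₅^-positive : ∀ k n → 1 ≤ n → 1 ≤ T₅^ k n
T₅^-positive zero    n 1≤n = 1≤n
T₅^-positive (suc k) n 1≤n = T₅-positive (T₅^ k n) (T₅^-positive k n 1≤n)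

T₅[m*2]≡m : ∀ m → T₅ (m * 2) ≡ m
T₅[m*2]≡m m rewrite m*n%n≡0 m 2 {{_}} = m*n/n≡m m 2

T₅^k[2^k*m]≡m : ∀ k m → T₅^ k (2 ^ k * m) ≡ m
T₅^k[2^k*m]≡m zero    m = *-identityˡ m
T₅^k[2^k*m]≡m (suc k) m = begin
  T₅ (T₅^ k (2 * 2 ^ k * m))   ≡⟨ cong (λ x → T₅ (T₅^ k x)) 2*2^k*m≡2^k*[m*2] ⟩
  T₅ (T₅^ k (2 ^ k * (m * 2))) ≡⟨ cong T₅ (T₅^k[2^k*m]≡m k (m * 2)) ⟩
  T₅ (m * 2)                   ≡⟨ T₅[m*2]≡m m ⟩
  m                            ∎
  where
  open ≡-Reasoning
  2*2^k*m≡2^k*[m*2] : 2 * 2 ^ k * m ≡ 2 ^ k * (m * 2)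
  2*2^k*m≡2^k*[m*2] = begin
    2 * 2 ^ k * m   ≡⟨ cong (_* m) (*-comm 2 (2 ^ k)) ⟩
    2 ^ k * 2 * m   ≡⟨ *-assoc (2 ^ k) 2 m ⟩
    2 ^ k * (2 * m) ≡⟨ cong (2 ^ k *_) (*-comm 2 m) ⟩
    2 ^ k * (m * 2) ∎

IsTMinus⇒positive : ∀ {n m} → 1 ≤ n → IsTMinus n m → 1 ≤ m
IsTMinus⇒positive {n} 1≤n ((k , T₅^kn≡m) , _) = subst (1 ≤_) T₅^kn≡m (T₅^-positive k n 1≤n)

IsTMinus-one : ∀ {n} k → 1 ≤ n → T₅^ k n ≡ 1 → IsTMinus n 1
IsTMinus-one {n} k 1≤n T₅^kn≡1 = (k , T₅^kn≡1) , λ j → T₅^-positive j n 1≤n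

IsTMinus[2^k]1 : ∀ k → IsTMinus (2 ^ k) 1
IsTMinus[2^k]1 k =
  IsTMinus-one k (m^n>0 2 k) (subst (λ x → T₅^ k x ≡ 1) (*-identityʳ (2 ^ k)) (T₅^k[2^k*m]≡m k 1))

n<2^n : ∀ n → n < 2 ^ n
n<2^n zero = z<s
n<2^n (suc n) rewrite +-identityʳ (2 ^ n) = +-mono-≤ (m^n>0 2 n) (n<2^n n)

theorem7p4 : ((n m : ℕ) → 1 ≤ n → IsTMinus n m → 1 ≤ m)
    × ((p q N : ℕ) → ∃ λ n → N ≤ n × (∃ λ m → IsTMinus n m × (m ^ suc q < n ^ suc p)))
theorem7p4 = (λ n m → IsTMinus⇒positive) , largePowerOfTwo
  where
  largePowerOfTwo : (p q N : ℕ) → ∃ λ n → N ≤ n × (∃ λ m → IsTMinus n m × (m ^ suc q < n ^ suc p))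
  largePowerOfTwo p q N = 2 ^ suc N , N≤2^[1+N] , 1 , IsTMinus[2^k]1 (suc N) , 1^[1+q]<n^[1+p]
    where
    N≤2^[1+N] : N ≤ 2 ^ suc N
    N≤2^[1+N] = ≤-trans (n≤1+n N) (<⇒≤ (n<2^n (suc N)))
    1^[1+q]<n^[1+p] : 1 ^ suc q < (2 ^ suc N) ^ suc p
    1^[1+q]<n^[1+p] = subst (_< (2 ^ suc N) ^ suc p) (trans (^-zeroˡ (suc p)) (sym (^-zeroˡ (suc q))))
                            (^-monoˡ-< (suc p) (^-monoʳ-< 2 (s≤s (s≤s z≤n)) {0} {suc N} z<s))
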